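{- Consider a flight $(i,j,k)$ and two speeds $v,s\in V$ with $s>v$. If $$\tau^v_{ijk} \leq \tau^{\text{T}}_{ik} \quad\text{and}\quad e^v_{ijk} \leq e^{s}_{ijk} + \left( \tau^v_{ijk} - \tau^{s}_{ijk} \right) P^{\text{H}}(0),$$ then the operation $(i,j,k)^s$ is dominated by the operation $(i,j,k)^v$.
   Context: Setting (vehicle routing problem with drones and drone speed selection). The nodes are a start depot $0$, customers $C=\{1,\dots,c\}$, and an end depot $c+1$ (same physical location as $0$); $\bar C\subseteq C$ is the set of customers that may be served by a drone. For nodes $a,b$, $\tau^{\text{T}}_{ab}\ge 0$ is the truck travel time from $a$ to $b$, and $\tau^{\text{S,T}}_l\ge 0$ is the truck service time at customer $l$. The drone distance between $a$ and $b$ is $\delta^{\text{D}}_{ab}\ge0$, the drone service time at customer $j$ is $\tau^{\text{S,D}}_j\ge 0$, and a drone can fly at any speed from a finite set $V\subset(0,\infty)$. A flight is a triple $(i,j,k)$ of pairwise distinct nodes (launch node $i\neq c+1$, customer $j\in\bar C$, retrieval node $k\neq 0$). An operation $(i,j,k)^v$ is the execution of the flight at constant speed $v\in V$; its duration is $\tau^v_{ijk}=\delta^{\text{D}}_{ij}/v+\tau^{\text{S,D}}_j+\delta^{\text{D}}_{jk}/v$, and its flight energy consumption is a given number $e^v_{ijk}\ge 0$. $P^{\text{H}}(0)>0$ denotes the power consumed by the drone when hovering without a package, and $\epsilon E>0$ is the maximum usable battery energy. Scenario semantics: measure time from the launch at $i$, at which moment the truck also leaves $i$. Let $T$ be the time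 at which the truck arrives at $k$. The drone reaches $k$ at time $\tau^v_{ijk}$ and hovers until the truck arrives, so the reunion occurs at time $\max(\tau^v_{ijk},T)$ and the energy consumed until reunion is $e^v_{ijk}+\max(T-\tau^v_{ijk},0)\,P^{\text{H}}(0)$. The operation is feasible in the scenario iff this energy is at most $\epsilon E$. Admissible scenarios: always $T\ge\tau^{\text{T}}_{ik}$; if the truck travels directly from $i$ to $k$ then $T=\tau^{\text{T}}_{ik}$; if the truck visits some customer $l\notin\{i,j,k\}$ between $i$ and $k$, then $T\ge \tau^{\text{T}}_{il}+\tau^{\text{S,T}}_l+\tau^{\text{T}}_{lk}$. Dominance: an operation $A$ of flight $(i,j,k)$ is dominated by an operation $B$ of the same flight if, in every admissible scenario in which $A$ is feasible, $B$ is also feasible, the reunion time with $B$ is no later than with $A$, and the energy consumed until reunion with $B$ is no larger than with $A$.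
   Formalization: All times, distances, drone speeds in V, flight energies, $P^{\text{H}}(0)$, $\epsilon E$ and the truck arrival time $T$ take rational values. -}

module Defs where

open import Data.Nat using (ℕ; suc)
open import Data.Fin using (Fin; zero; fromℕ)
open import Data.Bool using (Bool; true)
open import Data.List using (List)
open import Data.List.Membership.Propositional using (_∈_)
open import Data.Product using (Σ; _×_)
open import Data.Sum using (_⊎_)
open import Data.Rational using (ℚ; 0ℚ; _+_; _-_; _*_; _÷_; _⊔_; _≤_; _<_; Positive; NonNegative)
open import Data.Rational.Properties using (pos⇒nonZero)
open import Relation.Binary.PropositionalEquality using (_≡_; _≢_)

-- Nodes of an instance with c customers: 0 = start depot, 1..c customers,
-- c+1 = end depot.
Node : ℕ → Set
Node c = Fin (suc (suc c))

startDepot : ∀ {c} → Node c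
startDepot = zero

endDepot : ∀ {c} → Node c
endDepot {c} = fromℕ (suc c)

IsCustomer : ∀ {c} → Node c → Set
IsCustomer l = (l ≢ startDepot) × (l ≢ endDepot)

record Speed : Set where
  constructor speed
  field
    val : ℚ
    pos : Positive val
open Speed public

_/ₛ_ : ℚ → Speed → ℚ
d /ₛ v = (d ÷ val v) {{pos⇒nonZero (val v) {{pos v}}}}

record Instance (c : ℕ) : Set where
  field
    τT      : Node c → Node c → ℚ          -- truck travel time
    τT≥0    : ∀ a b → NonNegative (τT a b)
    τST     : Node c → ℚ                   -- truck service time
    τST≥0   : ∀ l → NonNegative (τST l)
    δD      : Node c → Node c → ℚ          -- drone distance
    δD≥0    : ∀ a b → NonNegative (δD a b)
    τSD     : Node c → ℚ                   -- drone service time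
    τSD≥0   : ∀ j → NonNegative (τSD j)
    droneOK : Node c → Bool                -- membership in C̄ (for customers)
    V       : List Speed
    e       : Node c → Node c → Node c → Speed → ℚ
    e≥0     : ∀ i j k v → NonNegative (e i j k v)
    PH0     : ℚ                            -- hover power without package
    PH0>0   : Positive PH0
    εE      : ℚ                            -- usable battery energy
    εE>0    : Positive εE

module _ {c : ℕ} (I : Instance c) where
  open Instance I

  InCbar : Node c → Set
  InCbar j = IsCustomer j × (droneOK j ≡ true)

  IsFlight : Node c → Node c → Node c → Set
  IsFlight i j k =
    (i ≢ j) × (j ≢ k) × (i ≢ k) × (i ≢ endDepot) × InCbar j × (k ≢ startDepot)

  duration : Node c → Node c → Node c → Speed → ℚ
  duration i j k v = (δD i j /ₛ v) + τSD j + (δD j k /ₛ v)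

  reunion : Node c → Node c → Node c → Speed → ℚ → ℚ
  reunion i j k v T = duration i j k v ⊔ T

  energy : Node c → Node c → Node c → Speed → ℚ → ℚ
  energy i j k v T = e i j k v + ((T - duration i j k v) ⊔ 0ℚ) * PH0

  Feasible : Node c → Node c → Node c → Speed → ℚ → Set
  Feasible i j k v T = energy i j k v T ≤ εE

  Admissible : Node c → Node c → Node c → ℚ → Set
  Admissible i j k T =
    (τT i k ≤ T) ×
    ((T ≡ τT i k) ⊎
     Σ (Node c) (λ l → IsCustomer l × (l ≢ i) × (l ≢ j) × (l ≢ k) ×
                       (τT i l + τST l + τT l k ≤ T)))

  DominatedBy : Node c → Node c → Node c → Speed → Speed → Set
  DominatedBy i j k a b =
    ∀ T → Admissible i j k T → Feasible i j k a T →
      Feasible i j k b T ×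
      (reunion i j k b T ≤ reunion i j k a T) ×
      (energy i j k b T ≤ energy i j k a T)

{-# OPTIONS --safe #-}
module Submission where

open import Defs
open import Data.Nat using (ℕ)
open import Data.List.Membership.Propositional using (_∈_)
open import Data.Rational using (ℚ; 0ℚ; -_; _+_; _-_; _*_; _≤_; _<_)
open import Data.Rational.Properties
open import Data.Rational.Solver using (module +-*-Solver)
open import Data.Product using (_,_; proj₁)
open import Relation.Binary.PropositionalEquality using (_≡_; refl; cong; subst)

-- The slow operation reaches k no later than the truck in every admissible
-- scenario, so its reunion time is T and it hovers for exactly T − τᵛ.
-- Splitting the fast operation's hover time T − τˢ at τᵛ, the energy
-- hypothesis says that hovering from τˢ to τᵛ already costs the fast drone
-- at least the extra flight energy of the slow one.

p≤q⇒0≤q-p : ∀ {p q : ℚ} → p ≤ q → 0ℚ ≤ q - p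
p≤q⇒0≤q-p {p} {q} p≤q = subst (_≤ q - p) (+-inverseʳ p) (+-monoˡ-≤ (- p) p≤q)

hover-split : ∀ x p q r P → (x + (q - r) * P) + (p - q) * P ≡ x + (p - r) * P
hover-split = solve 5 (λ x p q r P →
  (x :+ (q :- r) :* P) :+ (p :- q) :* P := x :+ (p :- r) :* P) refl
  where open +-*-Solver

module _ {c : ℕ} (I : Instance c) (i j k : Node c) where
  open Instance I

  reunion-after-arrival : ∀ v {T} → duration I i j k v ≤ T → reunion I i j k v T ≡ T
  reunion-after-arrival v = p≤q⇒p⊔q≡q

  T≤reunion : ∀ v T → T ≤ reunion I i j k v T
  T≤reunion v T = p≤q⊔p (duration I i j k v) T

  energy-after-arrival : ∀ v {T} → duration I i j k v ≤ T →
    energy I i j k v T ≡ e i j k v + (T - duration I i j k v) * PH0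
  energy-after-arrival v {T} τ≤T =
    cong (λ h → e i j k v + h * PH0) (p≥q⇒p⊔q≡p (p≤q⇒0≤q-p τ≤T))

  hover-energy≤energy : ∀ v T → e i j k v + (T - duration I i j k v) * PH0 ≤ energy I i j k v T
  hover-energy≤energy v T = +-monoʳ-≤ (e i j k v)
    (*-monoʳ-≤-nonNeg PH0 {{pos⇒nonNeg PH0 {{PH0>0}}}} (p≤p⊔q (T - duration I i j k v) 0ℚ))

proposition2 : ∀ {c : ℕ} (I : Instance c) (i j k : Node c) (v s : Speed) →
    IsFlight I i j k → v ∈ Instance.V I → s ∈ Instance.V I → val v < val s →
    duration I i j k v ≤ Instance.τT I i k →
    Instance.e I i j k v ≤ Instance.e I i j k s + (duration I i j k v - duration I i j k s) * Instance.PH0 I →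
    DominatedBy I i j k s v
proposition2 I i j k v s _ _ _ _ τᵛ≤τT eᵛ≤ T admissible feasibleˢ =
  ≤-trans energyᵛ≤energyˢ feasibleˢ , reunionᵛ≤reunionˢ , energyᵛ≤energyˢ
  where
  open Instance I
  open ≤-Reasoning
  τᵛ = duration I i j k v
  τˢ = duration I i j k s

  τᵛ≤T : τᵛ ≤ T
  τᵛ≤T = ≤-trans τᵛ≤τT (proj₁ admissible)

  reunionᵛ≤reunionˢ : reunion I i j k v T ≤ reunion I i j k s T
  reunionᵛ≤reunionˢ = begin
    reunion I i j k v T  ≡⟨ reunion-after-arrival I i j k v τᵛ≤T ⟩
    T                    ≤⟨ T≤reunion I i j k s T ⟩
    reunion I i j k s T  ∎

  energyᵛ≤energyˢ : energy I i j k v T ≤ energy I i j k s T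
  energyᵛ≤energyˢ = begin
    energy I i j k v T                                   ≡⟨ energy-after-arrival I i j k v τᵛ≤T ⟩
    e i j k v + (T - τᵛ) * PH0                           ≤⟨ +-monoˡ-≤ ((T - τᵛ) * PH0) eᵛ≤ ⟩
    (e i j k s + (τᵛ - τˢ) * PH0) + (T - τᵛ) * PH0       ≡⟨ hover-split (e i j k s) T τᵛ τˢ PH0 ⟩
    e i j k s + (T - τˢ) * PH0                           ≤⟨ hover-energy≤energy I i j k s T ⟩
    energy I i j k s T                                   ∎
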